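{- A valid pagination whose loss is minimal (among all valid paginations of the instance) is not necessarily optimal: there exist a finite collection $T$ of tiles and a capacity $C$ and a valid pagination of $T$ of minimal total loss whose number of pages is strictly larger than the minimum number of pages of a valid pagination of $T$.
   Context: An instance consists of a finite collection $T$ of nonempty finite sets (tiles) of symbols and an integer capacity $C>0$. A valid pagination is a partition of $T$ into nonempty parts (pages) such that each page $P$ has volume $V(P)=\left|\bigcup_{t\in P} t\right|\le C$. The loss of a page $P$ is $C-V(P)$ and the loss of a pagination is the sum of the losses of its pages. A valid pagination is optimal if it has the minimum number of pages among valid paginations of $T$. -}

module Defs where

open import Data.Nat using (ℕ; zero; suc; _+_; _∸_; _≤_)
open import Data.Fin using (Fin; _≟_)
open import Data.Fin.Subset using (Subset; _∪_; ⊥; ∣_∣)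
open import Data.Product using (∃)
open import Relation.Binary.PropositionalEquality using (_≡_)
open import Relation.Nullary using (yes; no)

-- An instance: n tiles over the symbol alphabet Fin m; tile i is the
-- subset  T i  of Fin m.  (Any finite symbol set can be encoded in Fin m.)
Tiles : ℕ → ℕ → Set
Tiles m n = Fin n → Subset m

-- A pagination of the n tiles into k pages is given by an assignment
-- f : Fin n → Fin k  sending each tile to its page; pages are the fibres
-- of f.  It is a partition into NONEMPTY parts iff f is surjective.
Surjective : ∀ {n k} → (Fin n → Fin k) → Set
Surjective {n} {k} f = (p : Fin k) → ∃ λ (i : Fin n) → f i ≡ p

pageUnion : ∀ {m n k} → Tiles m n → (Fin n → Fin k) → Fin k → Subset m
pageUnion {n = zero}  T f p = ⊥
pageUnion {n = suc n} T f p with f Fin.zero ≟ p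
... | yes _ = T Fin.zero ∪ pageUnion (λ i → T (Fin.suc i)) (λ i → f (Fin.suc i)) p
... | no  _ = pageUnion (λ i → T (Fin.suc i)) (λ i → f (Fin.suc i)) p

volume : ∀ {m n k} → Tiles m n → (Fin n → Fin k) → Fin k → ℕ
volume T f p = ∣ pageUnion T f p ∣

ValidPagination : ∀ {m n} → Tiles m n → ℕ → (k : ℕ) → (Fin n → Fin k) → Set
ValidPagination T C k f = Surjective f × ((p : Fin k) → volume T f p ≤ C)
  where open import Data.Product using (_×_)

sumFin : ∀ k → (Fin k → ℕ) → ℕ
sumFin zero    g = 0
sumFin (suc k) g = g Fin.zero + sumFin k (λ i → g (Fin.suc i))

-- loss of a pagination: sum over pages of C − V(P)
-- (for valid paginations V(P) ≤ C, so truncated subtraction is exact)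
loss : ∀ {m n} → Tiles m n → ℕ → (k : ℕ) → (Fin n → Fin k) → ℕ
loss T C k f = sumFin k (λ p → C ∸ volume T f p)

-- Loss does not penalise pages that are full.  Over the symbols a, b, c, d
-- with capacity 4, the tiles {a,b}, {c,d}, {a,c}, {b,d} can be split into the
-- two full pages {a,b},{c,d} and {a,c},{b,d}, a pagination of loss 0 and
-- hence of minimal loss; yet all four tiles fit together on a single page.
module Submission where

open import Defs
open import Data.Nat using (ℕ; _≤_; _<_; _∸_; z≤n; s≤s)
open import Data.Nat.Properties using (n∸n≡0; ≤-refl; ≤-reflexive)
open import Data.Fin using (Fin; zero; suc)
open import Data.Fin.Subset using (Nonempty; Subset; inside; outside)
open import Data.Vec using (_∷_; []; here; there)
open import Data.Product using (∃; Σ; _×_; _,_)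
open import Function.Definitions using (Injective)
open import Relation.Binary.PropositionalEquality using (_≡_; refl; sym; trans; cong)

sumFin-zero : ∀ k (g : Fin k → ℕ) → (∀ p → g p ≡ 0) → sumFin k g ≡ 0
sumFin-zero ℕ.zero    g g≡0 = refl
sumFin-zero (ℕ.suc k) g g≡0
  rewrite g≡0 zero = sumFin-zero k (λ p → g (suc p)) (λ p → g≡0 (suc p))

loss-full-pages : ∀ {m n} (T : Tiles m n) C k (f : Fin n → Fin k) →
                  (∀ p → volume T f p ≡ C) → loss T C k f ≡ 0
loss-full-pages T C k f full =
  sumFin-zero k (λ p → C ∸ volume T f p) (λ p → trans (cong (C ∸_) (full p)) (n∸n≡0 C))

loss-zero-minimal : ∀ {m n} (T : Tiles m n) C k (f : Fin n → Fin k) →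
                    loss T C k f ≡ 0 →
                    ∀ k′ (f′ : Fin n → Fin k′) → loss T C k f ≤ loss T C k′ f′
loss-zero-minimal T C k f loss≡0 k′ f′ rewrite loss≡0 = z≤n

single-page-surjective : ∀ {n} → Surjective {ℕ.suc n} {1} (λ _ → zero)
single-page-surjective zero = zero , refl

tiles : Tiles 4 4
tiles zero                   = inside  ∷ inside  ∷ outside ∷ outside ∷ []
tiles (suc zero)             = outside ∷ outside ∷ inside  ∷ inside  ∷ []
tiles (suc (suc zero))       = inside  ∷ outside ∷ inside  ∷ outside ∷ []
tiles (suc (suc (suc zero))) = outside ∷ inside  ∷ outside ∷ inside  ∷ []

-- The first two symbols already tell the four tiles apart.
tileIndex : Subset 4 → Fin 4
tileIndex (inside  ∷ inside  ∷ _) = zero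
tileIndex (outside ∷ outside ∷ _) = suc zero
tileIndex (inside  ∷ outside ∷ _) = suc (suc zero)
tileIndex (outside ∷ inside  ∷ _) = suc (suc (suc zero))

tileIndex-tiles : ∀ i → tileIndex (tiles i) ≡ i
tileIndex-tiles zero                   = refl
tileIndex-tiles (suc zero)             = refl
tileIndex-tiles (suc (suc zero))       = refl
tileIndex-tiles (suc (suc (suc zero))) = refl

tiles-injective : Injective _≡_ _≡_ tiles
tiles-injective {i} {j} eq =
  trans (sym (tileIndex-tiles i)) (trans (cong tileIndex eq) (tileIndex-tiles j))

tiles-nonempty : ∀ i → Nonempty (tiles i)
tiles-nonempty zero                   = zero , here
tiles-nonempty (suc zero)             = suc (suc zero) , there (there here)
tiles-nonempty (suc (suc zero))       = zero , here
tiles-nonempty (suc (suc (suc zero))) = suc zero , there here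

twoPages : Fin 4 → Fin 2
twoPages zero                   = zero
twoPages (suc zero)             = zero
twoPages (suc (suc zero))       = suc zero
twoPages (suc (suc (suc zero))) = suc zero

twoPages-full : ∀ p → volume tiles twoPages p ≡ 4
twoPages-full zero       = refl
twoPages-full (suc zero) = refl

twoPages-valid : ValidPagination tiles 4 2 twoPages
twoPages-valid = surjective , λ p → ≤-reflexive (twoPages-full p)
  where
  surjective : Surjective twoPages
  surjective zero       = zero , refl
  surjective (suc zero) = suc (suc zero) , refl

onePage-valid : ValidPagination tiles 4 1 (λ _ → zero)
onePage-valid = single-page-surjective , λ { zero → ≤-refl }

proposition3 :
    ∃ λ (m : ℕ) → ∃ λ (n : ℕ) → Σ (Tiles m n) λ T → ∃ λ (C : ℕ) →
      (0 < C) × Injective _≡_ _≡_ T × ((i : Fin n) → Nonempty (T i)) ×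
      (∃ λ (k : ℕ) → Σ (Fin n → Fin k) λ f →
        ValidPagination T C k f ×
        ((k′ : ℕ) → (f′ : Fin n → Fin k′) → ValidPagination T C k′ f′ →
           loss T C k f ≤ loss T C k′ f′) ×
        (∃ λ (k′ : ℕ) → Σ (Fin n → Fin k′) λ f′ →
           ValidPagination T C k′ f′ × k′ < k))
proposition3 =
  4 , 4 , tiles , 4 , s≤s z≤n , tiles-injective , tiles-nonempty ,
  2 , twoPages , twoPages-valid , minimal ,
  1 , (λ _ → zero) , onePage-valid , s≤s (s≤s z≤n)
  where
  minimal : ∀ k′ (f′ : Fin 4 → Fin k′) → ValidPagination tiles 4 k′ f′ →
            loss tiles 4 2 twoPages ≤ loss tiles 4 k′ f′
  minimal k′ f′ _ =
    loss-zero-minimal tiles 4 2 twoPages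
      (loss-full-pages tiles 4 2 twoPages twoPages-full) k′ f′
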